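{- If $H$ is a finite triangle-free graph, then $\overline{\Delta_2}(H)\ge \frac{|V(H)|}{2}-2$.
   Context: For vertices $v,w$ of $H$, the anti-codegree is $\overline{\operatorname{codeg}}(v,w)=|V(H)\setminus(N(v)\cup N(w)\cup\{v,w\})|$, the number of vertices other than $v,w$ adjacent to neither. $\overline{\Delta_2}(H)=\max_{v,w}\overline{\operatorname{codeg}}(v,w)$. -}

module Defs where

open import Data.Nat using (ℕ; zero; suc; _+_)
open import Data.Bool using (Bool; true; false; _∨_; not; if_then_else_)
open import Data.Fin using (Fin; _≟_)
open import Data.List using (List; length; filter)
open import Data.Fin.Base using ()
open import Data.List.Base using (allFin)
open import Relation.Nullary using (¬_; does)
open import Relation.Binary.PropositionalEquality using (_≡_; _≢_)
open import Data.Product using (_×_)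
open import Data.Empty using (⊥)

record Graph (n : ℕ) : Set where
  field
    adj   : Fin n → Fin n → Bool
    sym   : ∀ u v → adj u v ≡ adj v u
    irrefl : ∀ v → adj v v ≡ false

open Graph public

TriangleFree : ∀ {n} → Graph n → Set
TriangleFree G = ∀ u v w → adj G u v ≡ true → adj G v w ≡ true → adj G u w ≡ true → ⊥

isAnti : ∀ {n} → Graph n → Fin n → Fin n → Fin n → Bool
isAnti G v w x =
  not (adj G v x ∨ adj G w x ∨ does (x ≟ v) ∨ does (x ≟ w))

antiCodeg : ∀ {n} → Graph n → Fin n → Fin n → ℕ
antiCodeg {n} G v w = length (filter (λ x → Data.Bool._≟_ (isAnti G v w x) true) (allFin n))
  where import Data.Bool

{-# OPTIONS --safe #-}
-- A set S whose elements other than c, d are adjacent to neither c nor d has |S| ≤ anti(c,d) + 2,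
-- and every vertex outside N(a) ∪ N(b) ∪ {a,b} is anti to a and b.  So if one set S satisfies the
-- first bound for a pair (c,d) while |N(a) ∪ N(b) ∪ {a,b}| ≤ |S| + 2 for another pair (a,b), the
-- two anti-codegrees sum to at least n − 4 and the larger is at least n/2 − 2.  Triangle-freeness
-- makes neighbourhoods independent, which supplies such S.  Take u of degree ≥ 2 (if there is none,
-- any pair works) and a neighbour v.  If deg v ≤ 2, take S = N(u), (c,d) = (v,x) for a second
-- neighbour x of u, and the edge (a,b) = (u,v).  If uv lies on a 4-cycle u v w x, take
-- S = N(u) ∪ N(w) with (v,x) and (u,w).  Otherwise no neighbour w ≠ u of v is adjacent to
-- N(u) ∖ {v}, so S = (N(u) ∪ N(v)) ∖ {v} works for two such neighbours w, w' and the edge uv.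
module Submission where

open import Defs
open import Data.Nat using (ℕ; _+_; _*_; _≤_)
open import Data.Fin using (Fin)
open import Data.Product using (∃₂; _×_)
open import Relation.Binary.PropositionalEquality using (_≢_)

open import Function using (_∘_)
open import Data.Bool using (Bool; true; false)
open import Data.Bool.Properties using (¬-not) renaming (_≟_ to _≟ᵇ_)
open import Data.Nat using (suc; z≤n; s≤s; _≤?_)
open import Data.Nat.Properties
  using (≤-trans; ≤-reflexive; ≤-total; ≤-pred; ≰⇒>; n≤1+n; m≤n+m; +-suc;
         +-mono-≤; +-monoˡ-≤; +-monoʳ-≤; +-cancelʳ-≤; module ≤-Reasoning)
open import Data.Nat.Tactic.RingSolver using (solve-∀)
open import Data.Fin using (zero; suc; _≟_)
open import Data.Fin.Properties using (any?)
open import Data.Fin.Subset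
  using (Subset; inside; outside; _∈_; _∉_; _⊆_; _∪_; _─_; _-_; ⁅_⁆; ⊤; ∣_∣; Nonempty)
open import Data.Fin.Subset.Properties
  using (p⊆q⇒∣p∣≤∣q∣; p⊆p∪q; q⊆p∪q; x∈p∪q⁺; x∈p∪q⁻; ∪-idem; p─q⊆p; x∈p∧x≢y⇒x∈p-y;
         x∈⁅x⁆; ∣⁅x⁆∣≡1; ∣⊤∣≡n; ∣⊥∣≡0; nonempty?; Empty-unique)
open import Data.List using (length; filter)
import Data.List as List
open import Data.Vec using (_∷_; []; here; there)
import Data.Vec as Vec
open import Data.Vec.Properties using (lookup∘tabulate; lookup⇒[]=; []=⇒lookup)
open import Data.Product using (∃; _,_)
open import Data.Sum using (_⊎_; inj₁; inj₂)
open import Relation.Nullary using (Dec; yes; no; ¬_; contradiction)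
open import Relation.Nullary.Decidable using (dec-false; _×-dec_; ¬?)
open import Relation.Binary.PropositionalEquality
  using (_≡_; refl; trans; cong; cong₂; subst) renaming (sym to ≡-sym)

open ≤-Reasoning

∣tabulate∣≡length-filter : ∀ {n} {A : Set} (f : A → Bool) (g : Fin n → A) →
  ∣ Vec.tabulate (f ∘ g) ∣ ≡ length (filter (λ x → f x ≟ᵇ true) (List.tabulate g))
∣tabulate∣≡length-filter {0}     f g = refl
∣tabulate∣≡length-filter {suc n} f g with f (g zero)
... | true  = cong suc (∣tabulate∣≡length-filter f (g ∘ suc))
... | false = ∣tabulate∣≡length-filter f (g ∘ suc)

∣p∪q∣≤∣p∣+∣q∣ : ∀ {n} (p q : Subset n) → ∣ p ∪ q ∣ ≤ ∣ p ∣ + ∣ q ∣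
∣p∪q∣≤∣p∣+∣q∣ []            []            = z≤n
∣p∪q∣≤∣p∣+∣q∣ (inside  ∷ p) (inside  ∷ q) =
  s≤s (≤-trans (∣p∪q∣≤∣p∣+∣q∣ p q) (+-monoʳ-≤ ∣ p ∣ (n≤1+n ∣ q ∣)))
∣p∪q∣≤∣p∣+∣q∣ (inside  ∷ p) (outside ∷ q) = s≤s (∣p∪q∣≤∣p∣+∣q∣ p q)
∣p∪q∣≤∣p∣+∣q∣ (outside ∷ p) (inside  ∷ q) =
  ≤-trans (s≤s (∣p∪q∣≤∣p∣+∣q∣ p q)) (≤-reflexive (≡-sym (+-suc ∣ p ∣ ∣ q ∣)))
∣p∪q∣≤∣p∣+∣q∣ (outside ∷ p) (outside ∷ q) = ∣p∪q∣≤∣p∣+∣q∣ p q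

x∈p─q⇒x∉q : ∀ {n} {x : Fin n} {p q : Subset n} → x ∈ p ─ q → x ∉ q
x∈p─q⇒x∉q {p = _ ∷ _} {outside ∷ _} here        ()
x∈p─q⇒x∉q {p = _ ∷ _} {_       ∷ _} (there x∈) (there x∈q) = x∈p─q⇒x∉q x∈ x∈q

module _ {n : ℕ} where

  ∈-tabulate⁺ : ∀ {f : Fin n → Bool} {x} → f x ≡ true → x ∈ Vec.tabulate f
  ∈-tabulate⁺ {f} {x} fx = lookup⇒[]= x _ (trans (lookup∘tabulate f x) fx)

  ∈-tabulate⁻ : ∀ {f : Fin n → Bool} {x} → x ∈ Vec.tabulate f → f x ≡ true
  ∈-tabulate⁻ {f} {x} x∈ = trans (≡-sym (lookup∘tabulate f x)) ([]=⇒lookup x∈)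

  p⊆q∪r⇒∣p∣≤∣q∣+∣r∣ : ∀ {p q r : Subset n} → p ⊆ q ∪ r → ∣ p ∣ ≤ ∣ q ∣ + ∣ r ∣
  p⊆q∪r⇒∣p∣≤∣q∣+∣r∣ {q = q} {r} p⊆q∪r = ≤-trans (p⊆q⇒∣p∣≤∣q∣ p⊆q∪r) (∣p∪q∣≤∣p∣+∣q∣ q r)

  ∣⁅x⁆∪⁅y⁆∣≤2 : ∀ (x y : Fin n) → ∣ ⁅ x ⁆ ∪ ⁅ y ⁆ ∣ ≤ 2
  ∣⁅x⁆∪⁅y⁆∣≤2 x y =
    ≤-trans (∣p∪q∣≤∣p∣+∣q∣ ⁅ x ⁆ ⁅ y ⁆) (≤-reflexive (cong₂ _+_ (∣⁅x⁆∣≡1 x) (∣⁅x⁆∣≡1 y)))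

  x∈p-y⇒x≢y : ∀ {p : Subset n} {x y} → x ∈ p - y → x ≢ y
  x∈p-y⇒x≢y {y = y} x∈p-y refl = x∈p─q⇒x∉q x∈p-y (x∈⁅x⁆ y)

  ∣p∣≤∣p-x∣+1 : ∀ (p : Subset n) x → ∣ p ∣ ≤ ∣ p - x ∣ + 1
  ∣p∣≤∣p-x∣+1 p x = begin
    ∣ p ∣                 ≤⟨ p⊆q∪r⇒∣p∣≤∣q∣+∣r∣ p⊆p-x∪⁅x⁆ ⟩
    ∣ p - x ∣ + ∣ ⁅ x ⁆ ∣ ≡⟨ cong (∣ p - x ∣ +_) (∣⁅x⁆∣≡1 x) ⟩
    ∣ p - x ∣ + 1         ∎
    where
    p⊆p-x∪⁅x⁆ : p ⊆ (p - x) ∪ ⁅ x ⁆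
    p⊆p-x∪⁅x⁆ {y} y∈p with y ≟ x
    ... | yes refl = x∈p∪q⁺ (inj₂ (x∈⁅x⁆ x))
    ... | no  y≢x  = x∈p∪q⁺ (inj₁ (x∈p∧x≢y⇒x∈p-y y∈p y≢x))

  1≤∣p∣⇒Nonempty : ∀ {p : Subset n} → 1 ≤ ∣ p ∣ → Nonempty p
  1≤∣p∣⇒Nonempty {p} 1≤∣p∣ with nonempty? p
  ... | yes nonempty = nonempty
  ... | no  empty    = contradiction (subst (1 ≤_) ∣p∣≡0 1≤∣p∣) λ ()
    where
    ∣p∣≡0 : ∣ p ∣ ≡ 0
    ∣p∣≡0 = trans (cong ∣_∣ (Empty-unique empty)) (∣⊥∣≡0 n)

  ∃-∈-≢ : ∀ {p : Subset n} x → 2 ≤ ∣ p ∣ → ∃ λ y → y ∈ p × y ≢ x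
  ∃-∈-≢ {p} x 2≤∣p∣ with 1≤∣p∣⇒Nonempty (+-cancelʳ-≤ 1 1 _ (≤-trans 2≤∣p∣ (∣p∣≤∣p-x∣+1 p x)))
  ... | y , y∈p-x = y , p─q⊆p p ⁅ x ⁆ y∈p-x , x∈p-y⇒x≢y y∈p-x

  ∃-∈-≢₂ : ∀ {p : Subset n} x y → 3 ≤ ∣ p ∣ → ∃ λ z → z ∈ p × z ≢ x × z ≢ y
  ∃-∈-≢₂ {p} x y 3≤∣p∣ with ∃-∈-≢ y (+-cancelʳ-≤ 1 2 _ (≤-trans 3≤∣p∣ (∣p∣≤∣p-x∣+1 p x)))
  ... | z , z∈p-x , z≢y = z , p─q⊆p p ⁅ x ⁆ z∈p-x , x∈p-y⇒x≢y z∈p-x , z≢y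

x+2+2+x≡2*x+4 : ∀ x → x + 2 + 2 + x ≡ 2 * x + 4
x+2+2+x≡2*x+4 = solve-∀

larger-summand-bound : ∀ {n a b s} → s ≤ a + 2 → n ≤ s + 2 + b →
  n ≤ 2 * a + 4 ⊎ n ≤ 2 * b + 4
larger-summand-bound {n} {a} {b} {s} s≤a+2 n≤s+2+b with ≤-total a b
... | inj₁ a≤b = inj₂ (begin
  n             ≤⟨ n≤s+2+b ⟩
  s + 2 + b     ≤⟨ +-monoˡ-≤ b (+-monoˡ-≤ 2 (≤-trans s≤a+2 (+-monoˡ-≤ 2 a≤b))) ⟩
  b + 2 + 2 + b ≡⟨ x+2+2+x≡2*x+4 b ⟩
  2 * b + 4     ∎)
... | inj₂ b≤a = inj₁ (begin
  n             ≤⟨ n≤s+2+b ⟩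
  s + 2 + b     ≤⟨ +-mono-≤ (+-monoˡ-≤ 2 s≤a+2) b≤a ⟩
  a + 2 + 2 + a ≡⟨ x+2+2+x≡2*x+4 a ⟩
  2 * a + 4     ∎)

two-vertices : ∀ {n} → 2 ≤ n → ∃₂ λ (a b : Fin n) → a ≢ b
two-vertices (s≤s (s≤s _)) = zero , suc zero , λ ()

module _ {n : ℕ} (H : Graph n) where

  N : Fin n → Subset n
  N a = Vec.tabulate (adj H a)

  Anti : Fin n → Fin n → Subset n
  Anti a b = Vec.tabulate (isAnti H a b)

  ∣Anti∣≡antiCodeg : ∀ a b → ∣ Anti a b ∣ ≡ antiCodeg H a b
  ∣Anti∣≡antiCodeg a b = ∣tabulate∣≡length-filter (isAnti H a b) (λ x → x)

  adj-sym : ∀ {a b} → adj H a b ≡ true → adj H b a ≡ true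
  adj-sym {a} {b} ab = trans (sym H b a) ab

  adj⇒≢ : ∀ {a b} → adj H a b ≡ true → a ≢ b
  adj⇒≢ {a} ab refl = contradiction (trans (≡-sym ab) (irrefl H a)) λ ()

  isAnti-intro : ∀ {a b x} → adj H a x ≡ false → adj H b x ≡ false → x ≢ a → x ≢ b →
    isAnti H a b x ≡ true
  isAnti-intro {a} {b} {x} ax bx x≢a x≢b
    rewrite ax | bx | dec-false (x ≟ a) x≢a | dec-false (x ≟ b) x≢b = refl

  n≤∣p∣+antiCodeg : ∀ {a b} (p : Subset n) → N a ⊆ p → N b ⊆ p → a ∈ p → b ∈ p →
    n ≤ ∣ p ∣ + antiCodeg H a b
  n≤∣p∣+antiCodeg {a} {b} p Na⊆p Nb⊆p a∈p b∈p = begin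
    n                       ≡⟨ ∣⊤∣≡n n ⟨
    ∣ ⊤ {n} ∣               ≤⟨ p⊆q∪r⇒∣p∣≤∣q∣+∣r∣ ⊤⊆p∪Anti ⟩
    ∣ p ∣ + ∣ Anti a b ∣    ≡⟨ cong (∣ p ∣ +_) (∣Anti∣≡antiCodeg a b) ⟩
    ∣ p ∣ + antiCodeg H a b ∎
    where
    ⊤⊆p∪Anti : ⊤ ⊆ p ∪ Anti a b
    ⊤⊆p∪Anti {x} _ with adj H a x in ax | adj H b x in bx | x ≟ a | x ≟ b
    ... | true  | _     | _        | _        = x∈p∪q⁺ (inj₁ (Na⊆p (∈-tabulate⁺ ax)))
    ... | _     | true  | _        | _        = x∈p∪q⁺ (inj₁ (Nb⊆p (∈-tabulate⁺ bx)))
    ... | _     | _     | yes refl | _        = x∈p∪q⁺ (inj₁ a∈p)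
    ... | _     | _     | _        | yes refl = x∈p∪q⁺ (inj₁ b∈p)
    ... | false | false | no x≢a   | no x≢b   =
      x∈p∪q⁺ (inj₂ (∈-tabulate⁺ (isAnti-intro ax bx x≢a x≢b)))

  n≤∣Na∪Nb∣+2+antiCodeg : ∀ a b → n ≤ ∣ N a ∪ N b ∣ + 2 + antiCodeg H a b
  n≤∣Na∪Nb∣+2+antiCodeg a b = begin
    n                                   ≤⟨ n≤∣p∣+antiCodeg p Na⊆p Nb⊆p a∈p b∈p ⟩
    ∣ p ∣ + antiCodeg H a b             ≤⟨ +-monoˡ-≤ (antiCodeg H a b) ∣p∣≤∣Na∪Nb∣+2 ⟩
    ∣ N a ∪ N b ∣ + 2 + antiCodeg H a b ∎
    where
    p : Subset n
    p = (N a ∪ N b) ∪ (⁅ a ⁆ ∪ ⁅ b ⁆)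
    Na⊆p : N a ⊆ p
    Na⊆p = p⊆p∪q _ ∘ p⊆p∪q (N b)
    Nb⊆p : N b ⊆ p
    Nb⊆p = p⊆p∪q _ ∘ q⊆p∪q (N a) (N b)
    a∈p : a ∈ p
    a∈p = x∈p∪q⁺ (inj₂ (x∈p∪q⁺ (inj₁ (x∈⁅x⁆ a))))
    b∈p : b ∈ p
    b∈p = x∈p∪q⁺ (inj₂ (x∈p∪q⁺ (inj₂ (x∈⁅x⁆ b))))
    ∣p∣≤∣Na∪Nb∣+2 : ∣ p ∣ ≤ ∣ N a ∪ N b ∣ + 2
    ∣p∣≤∣Na∪Nb∣+2 =
      ≤-trans (∣p∪q∣≤∣p∣+∣q∣ (N a ∪ N b) _) (+-monoʳ-≤ ∣ N a ∪ N b ∣ (∣⁅x⁆∪⁅y⁆∣≤2 a b))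

  adj⇒n≤∣Na∪Nb∣+antiCodeg : ∀ {a b} → adj H a b ≡ true → n ≤ ∣ N a ∪ N b ∣ + antiCodeg H a b
  adj⇒n≤∣Na∪Nb∣+antiCodeg {a} {b} ab =
    n≤∣p∣+antiCodeg (N a ∪ N b) (p⊆p∪q (N b)) (q⊆p∪q (N a) (N b))
      (x∈p∪q⁺ (inj₂ (∈-tabulate⁺ (adj-sym ab)))) (x∈p∪q⁺ (inj₁ (∈-tabulate⁺ ab)))

  ∣S∣≤antiCodeg+2 : ∀ {a b} (S : Subset n) →
    (∀ {x} → x ∈ S → x ≢ a → x ≢ b → adj H a x ≡ false × adj H b x ≡ false) →
    ∣ S ∣ ≤ antiCodeg H a b + 2
  ∣S∣≤antiCodeg+2 {a} {b} S nonadjacent = begin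
    ∣ S ∣                               ≤⟨ p⊆q∪r⇒∣p∣≤∣q∣+∣r∣ S⊆Anti∪⁅a⁆∪⁅b⁆ ⟩
    ∣ Anti a b ∣ + ∣ ⁅ a ⁆ ∪ ⁅ b ⁆ ∣     ≡⟨ cong (_+ ∣ ⁅ a ⁆ ∪ ⁅ b ⁆ ∣) (∣Anti∣≡antiCodeg a b) ⟩
    antiCodeg H a b + ∣ ⁅ a ⁆ ∪ ⁅ b ⁆ ∣ ≤⟨ +-monoʳ-≤ (antiCodeg H a b) (∣⁅x⁆∪⁅y⁆∣≤2 a b) ⟩
    antiCodeg H a b + 2                 ∎
    where
    S⊆Anti∪⁅a⁆∪⁅b⁆ : S ⊆ Anti a b ∪ (⁅ a ⁆ ∪ ⁅ b ⁆)
    S⊆Anti∪⁅a⁆∪⁅b⁆ {x} x∈S with x ≟ a | x ≟ b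
    ... | yes refl | _        = x∈p∪q⁺ (inj₂ (x∈p∪q⁺ (inj₁ (x∈⁅x⁆ a))))
    ... | _        | yes refl = x∈p∪q⁺ (inj₂ (x∈p∪q⁺ (inj₂ (x∈⁅x⁆ b))))
    ... | no x≢a   | no x≢b   with nonadjacent x∈S x≢a x≢b
    ...   | ax , bx = x∈p∪q⁺ (inj₁ (∈-tabulate⁺ (isAnti-intro ax bx x≢a x≢b)))

  LargeAntiPair : Set
  LargeAntiPair = ∃₂ λ (v w : Fin n) → v ≢ w × n ≤ 2 * antiCodeg H v w + 4

  larger-of-two-pairs : ∀ {a b c d s} → a ≢ b → c ≢ d →
    s ≤ antiCodeg H a b + 2 → n ≤ s + 2 + antiCodeg H c d → LargeAntiPair
  larger-of-two-pairs a≢b c≢d s≤ n≤ with larger-summand-bound s≤ n≤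
  ... | inj₁ n≤2ab+4 = _ , _ , a≢b , n≤2ab+4
  ... | inj₂ n≤2cd+4 = _ , _ , c≢d , n≤2cd+4

  max-degree≤1 : 2 ≤ n → (∀ a → ∣ N a ∣ ≤ 1) → LargeAntiPair
  max-degree≤1 2≤n deg≤1 with two-vertices 2≤n
  ... | a , b , a≢b = larger-of-two-pairs a≢b a≢b ∣Na∪Nb∣≤2 (n≤∣Na∪Nb∣+2+antiCodeg a b)
    where
    ∣Na∪Nb∣≤2 : ∣ N a ∪ N b ∣ ≤ antiCodeg H a b + 2
    ∣Na∪Nb∣≤2 = ≤-trans (∣p∪q∣≤∣p∣+∣q∣ (N a) (N b))
                  (≤-trans (+-mono-≤ (deg≤1 a) (deg≤1 b)) (m≤n+m 2 (antiCodeg H a b)))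

  FourCycleThrough : Fin n → Fin n → Set
  FourCycleThrough u v = ∃₂ λ w x →
    w ≢ u × x ≢ v × adj H v w ≡ true × adj H w x ≡ true × adj H x u ≡ true

  four-cycle-through? : ∀ u v → Dec (FourCycleThrough u v)
  four-cycle-through? u v = any? λ w → any? λ x →
    ¬? (w ≟ u) ×-dec ¬? (x ≟ v) ×-dec
    (adj H v w ≟ᵇ true) ×-dec (adj H w x ≟ᵇ true) ×-dec (adj H x u ≟ᵇ true)

  module _ (tf : TriangleFree H) where

    neighbours-nonadjacent : ∀ {a b c} → adj H a b ≡ true → adj H a c ≡ true → adj H b c ≡ false
    neighbours-nonadjacent {a} {b} {c} ab ac = ¬-not λ bc → tf a b c ab bc ac

    ∣Na∪Nb∣≤antiCodeg+2 : ∀ {a b c d} →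
      adj H a c ≡ true → adj H a d ≡ true → adj H b c ≡ true → adj H b d ≡ true →
      ∣ N a ∪ N b ∣ ≤ antiCodeg H c d + 2
    ∣Na∪Nb∣≤antiCodeg+2 {a} {b} {c} {d} ac ad bc bd =
      ∣S∣≤antiCodeg+2 (N a ∪ N b) λ x∈ _ _ → nonadjacent (x∈p∪q⁻ (N a) (N b) x∈)
      where
      nonadjacent : ∀ {x} → x ∈ N a ⊎ x ∈ N b → adj H c x ≡ false × adj H d x ≡ false
      nonadjacent (inj₁ x∈Na) = let ax = ∈-tabulate⁻ x∈Na in
        neighbours-nonadjacent ac ax , neighbours-nonadjacent ad ax
      nonadjacent (inj₂ x∈Nb) = let bx = ∈-tabulate⁻ x∈Nb in
        neighbours-nonadjacent bc bx , neighbours-nonadjacent bd bx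

    low-degree-neighbour : ∀ {u v} → adj H u v ≡ true → 2 ≤ ∣ N u ∣ → ∣ N v ∣ ≤ 2 → LargeAntiPair
    low-degree-neighbour {u} {v} uv 2≤du dv≤2 with ∃-∈-≢ v 2≤du
    ... | x , x∈Nu , x≢v =
      larger-of-two-pairs (x≢v ∘ ≡-sym) (adj⇒≢ uv) ∣Nu∣≤antiCodeg[v,x]+2 (begin
      n                               ≤⟨ adj⇒n≤∣Na∪Nb∣+antiCodeg uv ⟩
      ∣ N u ∪ N v ∣ + antiCodeg H u v ≤⟨ +-monoˡ-≤ (antiCodeg H u v) ∣Nu∪Nv∣≤∣Nu∣+2 ⟩
      ∣ N u ∣ + 2 + antiCodeg H u v   ∎)
      where
      ux : adj H u x ≡ true
      ux = ∈-tabulate⁻ x∈Nu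
      ∣Nu∣≤antiCodeg[v,x]+2 : ∣ N u ∣ ≤ antiCodeg H v x + 2
      ∣Nu∣≤antiCodeg[v,x]+2 = subst (_≤ antiCodeg H v x + 2) (cong ∣_∣ (∪-idem (N u)))
                           (∣Na∪Nb∣≤antiCodeg+2 uv ux uv ux)
      ∣Nu∪Nv∣≤∣Nu∣+2 : ∣ N u ∪ N v ∣ ≤ ∣ N u ∣ + 2
      ∣Nu∪Nv∣≤∣Nu∣+2 = ≤-trans (∣p∪q∣≤∣p∣+∣q∣ (N u) (N v)) (+-monoʳ-≤ ∣ N u ∣ dv≤2)

    on-four-cycle : ∀ {u v} → adj H u v ≡ true → FourCycleThrough u v → LargeAntiPair
    on-four-cycle {u} {v} uv (w , x , w≢u , x≢v , vw , wx , xu) =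
      larger-of-two-pairs (x≢v ∘ ≡-sym) (w≢u ∘ ≡-sym)
        (∣Na∪Nb∣≤antiCodeg+2 uv (adj-sym xu) (adj-sym vw) wx) (n≤∣Na∪Nb∣+2+antiCodeg u w)

    no-four-cycle : ∀ {u v} → adj H u v ≡ true → 3 ≤ ∣ N v ∣ → ¬ FourCycleThrough u v →
      LargeAntiPair
    no-four-cycle {u} {v} uv 3≤dv no-C₄ with ∃-∈-≢ u (≤-trans (n≤1+n 2) 3≤dv)
    ... | w , w∈Nv , w≢u with ∃-∈-≢₂ u w 3≤dv
    ...   | w' , w'∈Nv , w'≢u , w'≢w =
      larger-of-two-pairs (w'≢w ∘ ≡-sym) (adj⇒≢ uv) ∣S∣≤antiCodeg[w,w']+2 (begin
      n                               ≤⟨ adj⇒n≤∣Na∪Nb∣+antiCodeg uv ⟩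
      ∣ N u ∪ N v ∣ + antiCodeg H u v ≤⟨ +-monoˡ-≤ (antiCodeg H u v) ∣Nu∪Nv∣≤∣S∣+2 ⟩
      ∣ S ∣ + 2 + antiCodeg H u v     ∎)
      where
      S : Subset n
      S = (N u ∪ N v) - v
      nonadjacent-to-Nu : ∀ {z x} → z ∈ N v → z ≢ u → x ∈ N u → x ≢ v → adj H z x ≡ false
      nonadjacent-to-Nu z∈Nv z≢u x∈Nu x≢v = ¬-not λ zx →
        no-C₄ (_ , _ , z≢u , x≢v , ∈-tabulate⁻ z∈Nv , zx , adj-sym (∈-tabulate⁻ x∈Nu))
      nonadjacent : ∀ {x} → x ∈ N u ⊎ x ∈ N v → x ≢ v → adj H w x ≡ false × adj H w' x ≡ false
      nonadjacent (inj₁ x∈Nu) x≢v =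
        nonadjacent-to-Nu w∈Nv w≢u x∈Nu x≢v , nonadjacent-to-Nu w'∈Nv w'≢u x∈Nu x≢v
      nonadjacent (inj₂ x∈Nv) _ = let vx = ∈-tabulate⁻ x∈Nv in
        neighbours-nonadjacent (∈-tabulate⁻ w∈Nv) vx , neighbours-nonadjacent (∈-tabulate⁻ w'∈Nv) vx
      ∣Nu∪Nv∣≤∣S∣+2 : ∣ N u ∪ N v ∣ ≤ ∣ S ∣ + 2
      ∣Nu∪Nv∣≤∣S∣+2 = ≤-trans (∣p∣≤∣p-x∣+1 (N u ∪ N v) v) (+-monoʳ-≤ ∣ S ∣ (n≤1+n 1))
      ∣S∣≤antiCodeg[w,w']+2 : ∣ S ∣ ≤ antiCodeg H w w' + 2
      ∣S∣≤antiCodeg[w,w']+2 = ∣S∣≤antiCodeg+2 S λ x∈S _ _ →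
        nonadjacent (x∈p∪q⁻ (N u) (N v) (p─q⊆p _ _ x∈S)) (x∈p-y⇒x≢y x∈S)

lemma5p1 : (n : ℕ) → 2 ≤ n → (H : Graph n) → TriangleFree H →
    ∃₂ λ (v w : Fin n) → (v ≢ w) × (n ≤ 2 * antiCodeg H v w + 4)
lemma5p1 n 2≤n H tf with any? (λ u → 2 ≤? ∣ N H u ∣)
... | no ∄u = max-degree≤1 H 2≤n λ u → ≤-pred (≰⇒> (∄u ∘ (u ,_)))
... | yes (u , 2≤du) with 1≤∣p∣⇒Nonempty (≤-trans (n≤1+n 1) 2≤du)
...   | v , v∈Nu with ∣ N H v ∣ ≤? 2 | four-cycle-through? H u v
...     | yes dv≤2 | _      = low-degree-neighbour H tf (∈-tabulate⁻ v∈Nu) 2≤du dv≤2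
...     | no  dv≰2 | yes C₄ = on-four-cycle H tf (∈-tabulate⁻ v∈Nu) C₄
...     | no  dv≰2 | no ¬C₄ = no-four-cycle H tf (∈-tabulate⁻ v∈Nu) (≰⇒> dv≰2) ¬C₄
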